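{- (1) There exists a $\mathtt{TPDL}$ sequent that is not cut-free provable in $\mathtt{GTPDL}$ but is cut-free provable in $\mathtt{CGTPDL}$; moreover, there exists a sequent that is not Fischer–Ladner-cut provable in $\mathtt{GTPDL}$ but is cut-free provable in $\mathtt{CGTPDL}$. (2) There exists a $\mathtt{TPDL}$ sequent that is provable in both $\mathtt{GTPDL}$ and $\mathtt{CGTPDL}$ but is cut-free provable in neither.
   Context: $\mathtt{TPDL}$ formulae/programs: $\varphi ::= \bot \mid p \mid (\varphi\to\varphi) \mid [\pi]\varphi \mid \overleftarrow{[\pi]}\varphi$, $\pi ::= \alpha \mid \pi;\pi \mid \pi\cup\pi \mid \pi^{*} \mid \varphi?$. Sequents are pairs of finite sets; commas denote union; $H\Gamma=\{H\varphi:\varphi\in\Gamma\}$. Common rules (premises $\Rightarrow$ conclusion; displayed compound formula in the conclusion is principal): (Ax) $\Rightarrow\Gamma\vdash\Delta$ if $\Gamma\cap\Delta\neq\emptyset$; ($\bot$) $\Rightarrow\Gamma,\bot\vdash\Delta$; ($\to$L) $\Gamma\vdash\varphi,\Delta$ and $\Gamma,\psi\vdash\Delta\Rightarrow\Gamma,\varphi\to\psi\vdash\Delta$; ($\to$R) $\Gamma,\varphi\vdash\psi,\Delta\Rightarrow\Gamma\vdash\varphi\to\psi,\Delta$; (Wk) $\Gamma\vdash\Delta\Rightarrow\Gamma'\vdash\Delta'$ for $\Gamma\subseteq\Gamma',\Delta\subseteq\Delta'$; (Cut) $\Gamma\vdash\varphi,\Delta$ and $\Gamma,\varphi\vdash\Delta\Rightarrow\Gamma\vdash\Delta$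 ($\varphi$ the cut formula); ($[\,]$) $\Gamma\vdash\varphi,\overleftarrow{[\pi]}\Delta\Rightarrow[\pi]\Gamma\vdash[\pi]\varphi,\Delta$; ($\overleftarrow{[\,]}$) $\Gamma\vdash\varphi,[\pi]\Delta\Rightarrow\overleftarrow{[\pi]}\Gamma\vdash\overleftarrow{[\pi]}\varphi,\Delta$; ($[;]$L) $\Gamma,[\pi_0][\pi_1]\varphi\vdash\Delta\Rightarrow\Gamma,[\pi_0;\pi_1]\varphi\vdash\Delta$; ($[;]$R) $\Gamma\vdash[\pi_0][\pi_1]\varphi,\Delta\Rightarrow\Gamma\vdash[\pi_0;\pi_1]\varphi,\Delta$; ($[\cup]$L) $\Gamma,[\pi_0]\varphi,[\pi_1]\varphi\vdash\Delta\Rightarrow\Gamma,[\pi_0\cup\pi_1]\varphi\vdash\Delta$; ($[\cup]$R) $\Gamma\vdash\Delta,[\pi_0]\varphi$ and $\Gamma\vdash\Delta,[\pi_1]\varphi\Rightarrow\Gamma\vdash[\pi_0\cup\pi_1]\varphi,\Delta$; ($[*]$L) $\Gamma,\varphi,[\pi][\pi^*]\varphi\vdash\Delta\Rightarrow\Gamma,[\pi^*]\varphi\vdash\Delta$; ($[?]$L) $\Gamma\vdash\varphi,\Delta$ and $\Gamma,\psi\vdash\Delta\Rightarrow\Gamma,[\varphi?]\psi\vdash\Delta$; ($[?]$R) $\Gamma,\varphi\vdash\psi,\Delta\Rightarrow\Gamma\vdash[\varphi?]\psi,\Delta$. $\mathtt{GTPDL}$: common rules plus ($[*]$R) $\Gamma,\varphi\vdash[\pi]\varphi\Rightarrow[\pi^*]\Gamma,\varphi\vdash[\pi^*]\varphi$;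 a $\mathtt{GTPDL}$ proof is a finite tree of sequents each node being the conclusion of a rule instance whose premises are exactly its children. $\mathtt{CGTPDL}$: common rules plus (C-s) $\Gamma\vdash\varphi,\Delta$ and $\Gamma\vdash[\pi][\pi^*]\varphi,\Delta\Rightarrow\Gamma\vdash[\pi^*]\varphi,\Delta$. A $\mathtt{CGTPDL}$ pre-proof is $(D,C)$: $D$ a finite tree of sequents each node being the conclusion of a rule instance with premises exactly its children or an unjustified leaf (bud); $C$ maps each bud to a companion, an inner node with the same sequent; the derivation graph identifies buds with companions. A path is a sequence of nodes $(\Gamma_i\vdash\Delta_i)$ each next a premise of the previous. A trace is $(\tau_i)$, $\tau_i\in\Delta_i$, with: at ($\to$R), principal $\varphi\to\psi\mapsto\psi$ or unchanged; at ($[\,]$), principal $[\pi]\varphi\mapsto\varphi$; at ($\overleftarrow{[\,]}$), principal $\overleftarrow{[\pi]}\varphi\mapsto\varphi$; at ($[;]$R), principal $\mapsto[\pi_0][\pi_1]\varphi$ or unchanged; at ($[\cup]$R) into the premise with $[\pi_j]\varphi$, principal $\mapsto[\pi_j]\varphi$ or unchanged; at ($[?]$R), principal $[\varphi?]\psi\mapsto\psi$ or unchanged; at (C-s) left premise, principal $[\pi^*]\varphi\mapsto\varphi$ or unchanged; at (C-s) right premise, principal $[\pi^*]\varphi\mapsto[\pi][\pi^*]\varphi$ (progress point) or unchanged; other rules, unchanged. A $\mathtt{CGTPDL}$ proof is a pre-proof in whose derivation graph every infinite path has a tail followed by a trace with infinitely many progress points. Cut-free: no (Cut) instances. Fischer–Ladner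 closure: $\mathrm{FL}(\bot)=\{\bot\}$, $\mathrm{FL}(p)=\{p\}$, $\mathrm{FL}(\psi_0\to\psi_1)=\{\psi_0\to\psi_1\}\cup\mathrm{FL}(\psi_0)\cup\mathrm{FL}(\psi_1)$, $\mathrm{FL}([\pi]\psi)=\mathrm{FL}_\Box([\pi]\psi)\cup\mathrm{FL}(\psi)$, $\mathrm{FL}(\overleftarrow{[\pi]}\psi)=\mathrm{FL}_\Box(\overleftarrow{[\pi]}\psi)\cup\mathrm{FL}(\psi)$, with $\mathrm{FL}_\Box([\alpha]\psi)=\{[\alpha]\psi\}$, $\mathrm{FL}_\Box([\pi_0;\pi_1]\psi)=\{[\pi_0;\pi_1]\psi\}\cup\mathrm{FL}_\Box([\pi_0][\pi_1]\psi)\cup\mathrm{FL}_\Box([\pi_1]\psi)$, $\mathrm{FL}_\Box([\pi_0\cup\pi_1]\psi)=\{[\pi_0\cup\pi_1]\psi\}\cup\mathrm{FL}_\Box([\pi_0]\psi)\cup\mathrm{FL}_\Box([\pi_1]\psi)$, $\mathrm{FL}_\Box([\pi^*]\psi)=\{[\pi^*]\psi\}\cup\mathrm{FL}_\Box([\pi][\pi^*]\psi)$, $\mathrm{FL}_\Box([\psi_0?]\psi_1)=\{[\psi_0?]\psi_1\}\cup\mathrm{FL}(\psi_0)$, and analogous clauses for $\overleftarrow{[\,]}$ with $\mathrm{FL}_\Box(\overleftarrow{[\pi_0;\pi_1]}\psi)=\{\overleftarrow{[\pi_0;\pi_1]}\psi\}\cup\mathrm{FL}_\Box(\overleftarrow{[\pi_1]}\overleftarrow{[\pi_0]}\psi)\cup\mathrm{FL}_\Box(\overleftarrow{[\pi_0]}\psi)$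 and $\mathrm{FL}_\Box(\overleftarrow{[\pi^*]}\psi)=\{\overleftarrow{[\pi^*]}\psi\}\cup\mathrm{FL}_\Box(\overleftarrow{[\pi]}\overleftarrow{[\pi^*]}\psi)$; $\mathrm{FL}(\Lambda)=\bigcup_{\varphi\in\Lambda}\mathrm{FL}(\varphi)$. A Fischer–Ladner cut is a (Cut) instance with conclusion $\Gamma\vdash\Delta$ whose cut formula lies in $\mathrm{FL}(\Gamma\cup\Delta)$; a sequent is Fischer–Ladner-cut provable in $\mathtt{GTPDL}$ if it has a $\mathtt{GTPDL}$ proof all of whose cuts are Fischer–Ladner cuts. -}

module Defs where

open import Data.Nat using (ℕ; zero; suc; _≤_)
open import Data.Fin using (Fin)
open import Data.List using (List; []; _∷_; _++_; map; length; lookup; concatMap)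
open import Data.List.Membership.Propositional using (_∈_)
open import Data.List.Relation.Binary.Subset.Propositional using (_⊆_)
open import Data.List.Relation.Binary.Pointwise using (Pointwise)
open import Data.Product using (Σ; _×_; _,_; proj₁; proj₂; ∃)
open import Data.Sum using (_⊎_)
open import Data.Unit using (⊤)
open import Data.Empty using (⊥)
open import Relation.Binary.PropositionalEquality using (_≡_)
open import Relation.Nullary using (¬_)

infixr 5 _⇒_
infixl 7 _⨾_
infixl 6 _∪_

mutual
  data Fm : Set where
    ⊥'   : Fm
    var  : ℕ → Fm
    _⇒_  : Fm → Fm → Fm
    box  : Pg → Fm → Fm
    bbox : Pg → Fm → Fm      -- backward box  ←[π]φ

  data Pg : Set where
    atom : ℕ → Pg
    _⨾_  : Pg → Pg → Pg
    _∪_  : Pg → Pg → Pg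
    star : Pg → Pg
    test : Fm → Pg

-- Sequents: pairs of finite sets, represented by lists up to
-- extensional (set) equality.

Seq : Set
Seq = List Fm × List Fm

_≈L_ : List Fm → List Fm → Set
A ≈L B = (A ⊆ B) × (B ⊆ A)

_≈S_ : Seq → Seq → Set
(Γ , Δ) ≈S (Γ' , Δ') = (Γ ≈L Γ') × (Δ ≈L Δ')

data Inst : Set where
  ax    : (Γ Δ : List Fm) (φ : Fm) → Inst
  botL  : (Γ Δ : List Fm) → Inst
  impL  : (Γ Δ : List Fm) (φ ψ : Fm) → Inst
  impR  : (Γ Δ : List Fm) (φ ψ : Fm) → Inst
  wk    : (Γ Δ Γ' Δ' : List Fm) → Γ ⊆ Γ' → Δ ⊆ Δ' → Inst
  cut   : (Γ Δ : List Fm) (φ : Fm) → Inst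
  boxR  : (π : Pg) (Γ : List Fm) (φ : Fm) (Δ : List Fm) → Inst
  bboxR : (π : Pg) (Γ : List Fm) (φ : Fm) (Δ : List Fm) → Inst
  seqL  : (π₀ π₁ : Pg) (φ : Fm) (Γ Δ : List Fm) → Inst
  seqR  : (π₀ π₁ : Pg) (φ : Fm) (Γ Δ : List Fm) → Inst
  cupL  : (π₀ π₁ : Pg) (φ : Fm) (Γ Δ : List Fm) → Inst
  cupR  : (π₀ π₁ : Pg) (φ : Fm) (Γ Δ : List Fm) → Inst
  starL : (π : Pg) (φ : Fm) (Γ Δ : List Fm) → Inst
  testL : (φ ψ : Fm) (Γ Δ : List Fm) → Inst
  testR : (φ ψ : Fm) (Γ Δ : List Fm) → Inst
  starR : (π : Pg) (Γ : List Fm) (φ : Fm) → Inst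
  cs    : (π : Pg) (φ : Fm) (Γ Δ : List Fm) → Inst

concl : Inst → Seq
concl (ax Γ Δ φ) = (φ ∷ Γ , φ ∷ Δ)
concl (botL Γ Δ) = (⊥' ∷ Γ , Δ)
concl (impL Γ Δ φ ψ) = ((φ ⇒ ψ) ∷ Γ , Δ)
concl (impR Γ Δ φ ψ) = (Γ , (φ ⇒ ψ) ∷ Δ)
concl (wk Γ Δ Γ' Δ' _ _) = (Γ' , Δ')
concl (cut Γ Δ φ) = (Γ , Δ)
concl (boxR π Γ φ Δ) = (map (box π) Γ , box π φ ∷ Δ)
concl (bboxR π Γ φ Δ) = (map (bbox π) Γ , bbox π φ ∷ Δ)
concl (seqL π₀ π₁ φ Γ Δ) = (box (π₀ ⨾ π₁) φ ∷ Γ , Δ)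
concl (seqR π₀ π₁ φ Γ Δ) = (Γ , box (π₀ ⨾ π₁) φ ∷ Δ)
concl (cupL π₀ π₁ φ Γ Δ) = (box (π₀ ∪ π₁) φ ∷ Γ , Δ)
concl (cupR π₀ π₁ φ Γ Δ) = (Γ , box (π₀ ∪ π₁) φ ∷ Δ)
concl (starL π φ Γ Δ) = (box (star π) φ ∷ Γ , Δ)
concl (testL φ ψ Γ Δ) = (box (test φ) ψ ∷ Γ , Δ)
concl (testR φ ψ Γ Δ) = (Γ , box (test φ) ψ ∷ Δ)
concl (starR π Γ φ) = (φ ∷ map (box (star π)) Γ , box (star π) φ ∷ [])
concl (cs π φ Γ Δ) = (Γ , box (star π) φ ∷ Δ)

prems : Inst → List Seq
prems (ax Γ Δ φ) = []
prems (botL Γ Δ) = []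
prems (impL Γ Δ φ ψ) = (Γ , φ ∷ Δ) ∷ (ψ ∷ Γ , Δ) ∷ []
prems (impR Γ Δ φ ψ) = (φ ∷ Γ , ψ ∷ Δ) ∷ []
prems (wk Γ Δ Γ' Δ' _ _) = (Γ , Δ) ∷ []
prems (cut Γ Δ φ) = (Γ , φ ∷ Δ) ∷ (φ ∷ Γ , Δ) ∷ []
prems (boxR π Γ φ Δ) = (Γ , φ ∷ map (bbox π) Δ) ∷ []
prems (bboxR π Γ φ Δ) = (Γ , φ ∷ map (box π) Δ) ∷ []
prems (seqL π₀ π₁ φ Γ Δ) = (box π₀ (box π₁ φ) ∷ Γ , Δ) ∷ []
prems (seqR π₀ π₁ φ Γ Δ) = (Γ , box π₀ (box π₁ φ) ∷ Δ) ∷ []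
prems (cupL π₀ π₁ φ Γ Δ) = (box π₀ φ ∷ box π₁ φ ∷ Γ , Δ) ∷ []
prems (cupR π₀ π₁ φ Γ Δ) = (Γ , box π₀ φ ∷ Δ) ∷ (Γ , box π₁ φ ∷ Δ) ∷ []
prems (starL π φ Γ Δ) = (φ ∷ box π (box (star π) φ) ∷ Γ , Δ) ∷ []
prems (testL φ ψ Γ Δ) = (Γ , φ ∷ Δ) ∷ (ψ ∷ Γ , Δ) ∷ []
prems (testR φ ψ Γ Δ) = (φ ∷ Γ , ψ ∷ Δ) ∷ []
prems (starR π Γ φ) = (φ ∷ Γ , box π φ ∷ []) ∷ []
prems (cs π φ Γ Δ) = (Γ , φ ∷ Δ) ∷ (Γ , box π (box (star π) φ) ∷ Δ) ∷ []

isG : Inst → Set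
isG (cs _ _ _ _) = ⊥
isG _ = ⊤

isC : Inst → Set
isC (starR _ _ _) = ⊥
isC _ = ⊤

notCut : Inst → Set
notCut (cut _ _ _) = ⊥
notCut _ = ⊤

mutual
  FL : Fm → List Fm
  FL ⊥' = ⊥' ∷ []
  FL (var p) = var p ∷ []
  FL (φ ⇒ ψ) = (φ ⇒ ψ) ∷ FL φ ++ FL ψ
  FL (box π ψ) = FLB π ψ ++ FL ψ
  FL (bbox π ψ) = FLBb π ψ ++ FL ψ

  FLB : Pg → Fm → List Fm
  FLB (atom a) ψ = box (atom a) ψ ∷ []
  FLB (π₀ ⨾ π₁) ψ = box (π₀ ⨾ π₁) ψ ∷ FLB π₀ (box π₁ ψ) ++ FLB π₁ ψ
  FLB (π₀ ∪ π₁) ψ = box (π₀ ∪ π₁) ψ ∷ FLB π₀ ψ ++ FLB π₁ ψ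
  FLB (star π) ψ = box (star π) ψ ∷ FLB π (box (star π) ψ)
  FLB (test χ) ψ = box (test χ) ψ ∷ FL χ

  FLBb : Pg → Fm → List Fm
  FLBb (atom a) ψ = bbox (atom a) ψ ∷ []
  FLBb (π₀ ⨾ π₁) ψ = bbox (π₀ ⨾ π₁) ψ ∷ FLBb π₁ (bbox π₀ ψ) ++ FLBb π₀ ψ
  FLBb (π₀ ∪ π₁) ψ = bbox (π₀ ∪ π₁) ψ ∷ FLBb π₀ ψ ++ FLBb π₁ ψ
  FLBb (star π) ψ = bbox (star π) ψ ∷ FLBb π (bbox (star π) ψ)
  FLBb (test χ) ψ = bbox (test χ) ψ ∷ FL χ

FLs : List Fm → List Fm
FLs = concatMap FL

flCutOK : Inst → Set
flCutOK (cut Γ Δ φ) = φ ∈ FLs (Γ ++ Δ)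
flCutOK _ = ⊤

-- Finite trees of sequents, possibly with buds (unjustified leaves).

data PT : Set where
  bud  : Seq → PT
  node : Seq → Inst → List PT → PT

label : PT → Seq
label (bud s) = s
label (node s _ _) = s

kids : PT → List PT
kids (bud _) = []
kids (node _ _ ts) = ts

mutual
  WF : (Inst → Set) → PT → Set
  WF A (bud _) = ⊤
  WF A (node s r ts) =
    A r × (s ≈S concl r) × Pointwise _≈S_ (map label ts) (prems r) × WFs A ts

  WFs : (Inst → Set) → List PT → Set
  WFs A [] = ⊤
  WFs A (t ∷ ts) = WF A t × WFs A ts

mutual
  NoBuds : PT → Set
  NoBuds (bud _) = ⊥
  NoBuds (node _ _ ts) = NoBudsL ts

  NoBudsL : List PT → Set
  NoBudsL [] = ⊤
  NoBudsL (t ∷ ts) = NoBuds t × NoBudsL ts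

GProof : (Inst → Set) → Seq → Set
GProof A s = Σ PT λ t → WF A t × NoBuds t × (label t ≈S s)

ProvG CutFreeProvG FLCutProvG : Seq → Set
ProvG = GProof isG
CutFreeProvG = GProof (λ r → isG r × notCut r)
FLCutProvG = GProof (λ r → isG r × flCutOK r)

data Pos : PT → Set where
  here  : ∀ {t} → Pos t
  child : ∀ {s r ts} (i : Fin (length ts)) → Pos (lookup ts i) → Pos (node s r ts)

sub : (t : PT) → Pos t → PT
sub t here = t
sub (node s r ts) (child i p) = sub (lookup ts i) p

extend : (t : PT) (p : Pos t) → Fin (length (kids (sub t p))) → Pos t
extend (node s r ts) here i = child i here
extend (node s r ts) (child j p) i = child j (extend (lookup ts j) p i)

IsBud IsInner : PT → Set
IsBud t = Σ Seq λ s → t ≡ bud s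
IsInner t = Σ Seq λ s → Σ Inst λ r → Σ (List PT) λ ts → t ≡ node s r ts

Companion : PT → Set
Companion t =
  Σ ((p : Pos t) → IsBud (sub t p) → Pos t) λ C →
    (p : Pos t) (b : IsBud (sub t p)) →
      IsInner (sub t (C p b)) × (label (sub t (C p b)) ≈S label (sub t p))

-- edges of the derivation graph (buds identified with their companions);
-- the ℕ records which premise is followed
Edge : (t : PT) → ((p : Pos t) → IsBud (sub t p) → Pos t) → Pos t → ℕ → Pos t → Set
Edge t C p j q =
  Σ (Fin (length (kids (sub t p)))) λ i →
    (Data.Fin.toℕ i ≡ j) ×
    ((IsInner (sub t (extend t p i)) × (q ≡ extend t p i))
     ⊎ (Σ (IsBud (sub t (extend t p i))) λ b → q ≡ C (extend t p i) b))

TStep : Inst → ℕ → Fm → Fm → Set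
TStep (boxR π Γ φ Δ) _ τ τ' = (τ ≡ box π φ) × (τ' ≡ φ)
TStep (bboxR π Γ φ Δ) _ τ τ' = (τ ≡ bbox π φ) × (τ' ≡ φ)
TStep (impR Γ Δ φ ψ) _ τ τ' = (τ' ≡ τ) ⊎ ((τ ≡ (φ ⇒ ψ)) × (τ' ≡ ψ))
TStep (seqR π₀ π₁ φ Γ Δ) _ τ τ' =
  (τ' ≡ τ) ⊎ ((τ ≡ box (π₀ ⨾ π₁) φ) × (τ' ≡ box π₀ (box π₁ φ)))
TStep (cupR π₀ π₁ φ Γ Δ) zero τ τ' =
  (τ' ≡ τ) ⊎ ((τ ≡ box (π₀ ∪ π₁) φ) × (τ' ≡ box π₀ φ))
TStep (cupR π₀ π₁ φ Γ Δ) (suc _) τ τ' =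
  (τ' ≡ τ) ⊎ ((τ ≡ box (π₀ ∪ π₁) φ) × (τ' ≡ box π₁ φ))
TStep (testR φ ψ Γ Δ) _ τ τ' = (τ' ≡ τ) ⊎ ((τ ≡ box (test φ) ψ) × (τ' ≡ ψ))
TStep (cs π φ Γ Δ) zero τ τ' = (τ' ≡ τ) ⊎ ((τ ≡ box (star π) φ) × (τ' ≡ φ))
TStep (cs π φ Γ Δ) (suc _) τ τ' =
  (τ' ≡ τ) ⊎ ((τ ≡ box (star π) φ) × (τ' ≡ box π (box (star π) φ)))
TStep _ _ τ τ' = τ' ≡ τ

Progress : Inst → ℕ → Fm → Fm → Set
Progress (cs π φ Γ Δ) (suc zero) τ τ' =
  (τ ≡ box (star π) φ) × (τ' ≡ box π (box (star π) φ))
Progress _ _ _ _ = ⊥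

TStepAt ProgressAt : PT → ℕ → Fm → Fm → Set
TStepAt (bud _) _ _ _ = ⊥
TStepAt (node _ r _) = TStep r
ProgressAt (bud _) _ _ _ = ⊥
ProgressAt (node _ r _) = Progress r

GlobalTrace : (t : PT) → ((p : Pos t) → IsBud (sub t p) → Pos t) → Set
GlobalTrace t C =
  (v : ℕ → Pos t) (j : ℕ → ℕ) → (∀ i → Edge t C (v i) (j i) (v (suc i))) →
  Σ ℕ λ k → Σ (ℕ → Fm) λ τ →
    (∀ i → k ≤ i →
       (τ i ∈ proj₂ (label (sub t (v i)))) ×
       TStepAt (sub t (v i)) (j i) (τ i) (τ (suc i))) ×
    (∀ m → Σ ℕ λ i → (m ≤ i) × (k ≤ i) ×
       ProgressAt (sub t (v i)) (j i) (τ i) (τ (suc i)))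

CProof : (Inst → Set) → Seq → Set
CProof A s =
  Σ PT λ t → WF A t × (label t ≈S s) ×
    Σ (Companion t) λ C → GlobalTrace t (proj₁ C)

ProvC CutFreeProvC : Seq → Set
ProvC = CProof isC
CutFreeProvC = CProof (λ r → isC r × notCut r)

-- Non-provability is shown by invariants: a property of sequents that holds of the
-- end-sequent and that every allowed rule instance passes from its conclusion to some
-- premise excludes finite proofs, and excludes cyclic proofs too if it can always be
-- passed on without crossing a progress point.  Each invariant says: the sequent has
-- a fixed syntactic shape, or it is refuted in the two-world model in which every
-- atomic program leads to w₁ and p holds only at w₀ (refutation passes on by soundness).
--
-- (1) S₁ = q, [α*](q→[α]q), [α*](q→p) ⊢ [α*]p.  The shape: antecedent inside the
-- Fischer–Ladner closure of S₁'s antecedent, succedent among [α*]p, [α][α*]p and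
-- their ←[α]-boxes.  Fischer–Ladner cuts and (□) on [α][α*]p stay in the shape,
-- while (□) and [*]R on [α*]p, and (←□), produce refuted premises.  In CGTPDL,
-- (C-s) on [α*]p unfolds the induction instead: after [*]L on both boxes and →L on
-- q→[α]q, (□) for α returns to S₁, and the trace [α*]p, [α][α*]p, … progresses once
-- per cycle.
--
-- (2) S₂ = r ⊢ [α]¬←[α]¬r is proved by a cut on ¬r.  Cut-free, the only rule besides
-- weakening that applies to a subsequent of S₂ is (□) on the succedent, whose premise
-- is refuted at w₁; all premises stay star-free, so no progress point is ever met.

module Submission where

open import Defs
open import Data.Product using (Σ; _×_)
open import Relation.Nullary using (¬_)

open import Data.Bool using (Bool; true; false; _∧_; _∨_; not)
open import Data.Bool.Properties using (∧-zeroʳ)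
open import Data.Empty using (⊥; ⊥-elim)
open import Data.Fin using (Fin; toℕ) renaming (zero to fzero; suc to fsuc)
open import Data.List using (List; []; _∷_; _++_; map; length; lookup)
open import Data.List.Membership.Propositional using (_∈_)
open import Data.List.Relation.Binary.Pointwise as Pointwise using (Pointwise; []; _∷_)
open import Data.List.Relation.Binary.Subset.Propositional using (_⊆_)
open import Data.List.Relation.Binary.Subset.Propositional.Properties using (⊆-refl; All-resp-⊇)
open import Data.List.Relation.Unary.All as All using (All; []; _∷_)
import Data.List.Relation.Unary.All.Properties as All
open import Data.List.Relation.Unary.Any as Any using (Any; here; there)
import Data.List.Relation.Unary.Any.Properties as Any
open import Data.Nat as ℕ using (ℕ; zero; suc; _≤_; _<_; _⊔_; s≤s; z≤n)
open import Data.Nat.Properties using (≤-refl; ≤-trans; ≤-pred; m≤m⊔n; m≤n⊔m; n≤1+n)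
open import Data.Product using (∃; _,_; proj₁; proj₂; uncurry)
open import Data.Sum using (_⊎_; inj₁; inj₂)
open import Data.Unit using (⊤; tt)
open import Function using (_∘_; flip)
open import Relation.Binary.Definitions using (DecidableEquality; Decidable; _Respects_)
open import Relation.Binary.PropositionalEquality using (_≡_; refl; sym; trans; cong; cong₂; subst)
open import Relation.Nullary.Decidable using (yes; no; map′; _×-dec_; True; toWitness)

infix 4 _≟ᶠ_ _≟ᵖ_

mutual
  _≟ᶠ_ : DecidableEquality Fm
  ⊥' ≟ᶠ ⊥' = yes refl
  var m ≟ᶠ var n = map′ (cong var) (λ { refl → refl }) (m ℕ.≟ n)
  (φ ⇒ ψ) ≟ᶠ (φ' ⇒ ψ') =
    map′ (uncurry (cong₂ _⇒_)) (λ { refl → refl , refl }) (φ ≟ᶠ φ' ×-dec ψ ≟ᶠ ψ')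
  box π φ ≟ᶠ box π' φ' =
    map′ (uncurry (cong₂ box)) (λ { refl → refl , refl }) (π ≟ᵖ π' ×-dec φ ≟ᶠ φ')
  bbox π φ ≟ᶠ bbox π' φ' =
    map′ (uncurry (cong₂ bbox)) (λ { refl → refl , refl }) (π ≟ᵖ π' ×-dec φ ≟ᶠ φ')
  ⊥' ≟ᶠ var _ = no λ ()
  ⊥' ≟ᶠ (_ ⇒ _) = no λ ()
  ⊥' ≟ᶠ box _ _ = no λ ()
  ⊥' ≟ᶠ bbox _ _ = no λ ()
  var _ ≟ᶠ ⊥' = no λ ()
  var _ ≟ᶠ (_ ⇒ _) = no λ ()
  var _ ≟ᶠ box _ _ = no λ ()
  var _ ≟ᶠ bbox _ _ = no λ ()
  (_ ⇒ _) ≟ᶠ ⊥' = no λ ()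
  (_ ⇒ _) ≟ᶠ var _ = no λ ()
  (_ ⇒ _) ≟ᶠ box _ _ = no λ ()
  (_ ⇒ _) ≟ᶠ bbox _ _ = no λ ()
  box _ _ ≟ᶠ ⊥' = no λ ()
  box _ _ ≟ᶠ var _ = no λ ()
  box _ _ ≟ᶠ (_ ⇒ _) = no λ ()
  box _ _ ≟ᶠ bbox _ _ = no λ ()
  bbox _ _ ≟ᶠ ⊥' = no λ ()
  bbox _ _ ≟ᶠ var _ = no λ ()
  bbox _ _ ≟ᶠ (_ ⇒ _) = no λ ()
  bbox _ _ ≟ᶠ box _ _ = no λ ()

  _≟ᵖ_ : DecidableEquality Pg
  atom m ≟ᵖ atom n = map′ (cong atom) (λ { refl → refl }) (m ℕ.≟ n)
  (π₀ ⨾ π₁) ≟ᵖ (ρ₀ ⨾ ρ₁) =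
    map′ (uncurry (cong₂ _⨾_)) (λ { refl → refl , refl }) (π₀ ≟ᵖ ρ₀ ×-dec π₁ ≟ᵖ ρ₁)
  (π₀ ∪ π₁) ≟ᵖ (ρ₀ ∪ ρ₁) =
    map′ (uncurry (cong₂ _∪_)) (λ { refl → refl , refl }) (π₀ ≟ᵖ ρ₀ ×-dec π₁ ≟ᵖ ρ₁)
  star π ≟ᵖ star ρ = map′ (cong star) (λ { refl → refl }) (π ≟ᵖ ρ)
  test φ ≟ᵖ test ψ = map′ (cong test) (λ { refl → refl }) (φ ≟ᶠ ψ)
  atom _ ≟ᵖ (_ ⨾ _) = no λ ()
  atom _ ≟ᵖ (_ ∪ _) = no λ ()
  atom _ ≟ᵖ star _ = no λ ()
  atom _ ≟ᵖ test _ = no λ ()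
  (_ ⨾ _) ≟ᵖ atom _ = no λ ()
  (_ ⨾ _) ≟ᵖ (_ ∪ _) = no λ ()
  (_ ⨾ _) ≟ᵖ star _ = no λ ()
  (_ ⨾ _) ≟ᵖ test _ = no λ ()
  (_ ∪ _) ≟ᵖ atom _ = no λ ()
  (_ ∪ _) ≟ᵖ (_ ⨾ _) = no λ ()
  (_ ∪ _) ≟ᵖ star _ = no λ ()
  (_ ∪ _) ≟ᵖ test _ = no λ ()
  star _ ≟ᵖ atom _ = no λ ()
  star _ ≟ᵖ (_ ⨾ _) = no λ ()
  star _ ≟ᵖ (_ ∪ _) = no λ ()
  star _ ≟ᵖ test _ = no λ ()
  test _ ≟ᵖ atom _ = no λ ()
  test _ ≟ᵖ (_ ⨾ _) = no λ ()
  test _ ≟ᵖ (_ ∪ _) = no λ ()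
  test _ ≟ᵖ star _ = no λ ()

open import Data.List.Relation.Binary.Subset.DecPropositional _≟ᶠ_ using (_⊆?_)

⊆-byDecision : ∀ {xs ys : List Fm} {xs⊆?ys : True (xs ⊆? ys)} → xs ⊆ ys
⊆-byDecision {xs⊆?ys = xs⊆?ys} = toWitness xs⊆?ys

_≈S?_ : Decidable _≈S_
(Γ , Δ) ≈S? (Γ' , Δ') = (Γ ⊆? Γ' ×-dec Γ' ⊆? Γ) ×-dec (Δ ⊆? Δ' ×-dec Δ' ⊆? Δ)

≈S-refl : ∀ {s} → s ≈S s
≈S-refl = (⊆-refl , ⊆-refl) , (⊆-refl , ⊆-refl)

≈S-sym : ∀ {s s'} → s ≈S s' → s' ≈S s
≈S-sym ((Γ⊆ , ⊇Γ) , (Δ⊆ , ⊇Δ)) = (⊇Γ , Γ⊆) , (⊇Δ , Δ⊆)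

_⊆ˢ_ : Seq → Seq → Set
(Γ , Δ) ⊆ˢ (Γ' , Δ') = (Γ ⊆ Γ') × (Δ ⊆ Δ')

≈S⇒⊇ˢ : ∀ {s s'} → s ≈S s' → s' ⊆ˢ s
≈S⇒⊇ˢ ((_ , ⊇Γ) , (_ , ⊇Δ)) = ⊇Γ , ⊇Δ

Sides : (Fm → Set) → (Fm → Set) → Seq → Set
Sides P Q (Γ , Δ) = All P Γ × All Q Δ

Sides-⊇ˢ : ∀ {P Q s s'} → s' ⊆ˢ s → Sides P Q s → Sides P Q s'
Sides-⊇ˢ (Γ'⊆Γ , Δ'⊆Δ) (PΓ , QΔ) = All-resp-⊇ Γ'⊆Γ PΓ , All-resp-⊇ Δ'⊆Δ QΔ

Sides-resp : ∀ {P Q} → Sides P Q Respects _≈S_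
Sides-resp s≈s' = Sides-⊇ˢ (≈S⇒⊇ˢ s≈s')

-- The side condition  s ≈S concl ι  is decided, so for a concrete derivation it is
-- discharged by evaluation and only the rule instances need to be written.
data Derivation (A : Inst → Set) (Bud : Seq → Set) : Seq → Set where
  bud : ∀ {s} → Bud s → Derivation A Bud s
  by  : ∀ {s} (ι : Inst) → A ι → {True (s ≈S? concl ι)} →
        All (Derivation A Bud) (prems ι) → Derivation A Bud s

module _ {A : Inst → Set} {Bud : Seq → Set} where

  mutual
    tree : ∀ {s} → Derivation A Bud s → PT
    tree (bud {s} _) = bud s
    tree (by {s} ι _ ds) = node s ι (trees ds)

    trees : ∀ {ss} → All (Derivation A Bud) ss → List PT
    trees [] = []
    trees (d ∷ ds) = tree d ∷ trees ds

  tree-label : ∀ {s} (d : Derivation A Bud s) → label (tree d) ≡ s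
  tree-label (bud _) = refl
  tree-label (by _ _ _) = refl

  tree-≈ : ∀ {s} (d : Derivation A Bud s) → label (tree d) ≈S s
  tree-≈ d = subst (_≈S _) (sym (tree-label d)) ≈S-refl

  trees-labels : ∀ {ss} (ds : All (Derivation A Bud) ss) → Pointwise _≈S_ (map label (trees ds)) ss
  trees-labels [] = []
  trees-labels (d ∷ ds) rewrite tree-label d = ≈S-refl ∷ trees-labels ds

  mutual
    tree-wf : ∀ {s} (d : Derivation A Bud s) → WF A (tree d)
    tree-wf (bud _) = tt
    tree-wf (by ι a {ok} ds) = a , toWitness ok , trees-labels ds , trees-wf ds

    trees-wf : ∀ {ss} (ds : All (Derivation A Bud) ss) → WFs A (trees ds)
    trees-wf [] = tt
    trees-wf (d ∷ ds) = tree-wf d , trees-wf ds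

  mutual
    buds-valid : ∀ {s} (d : Derivation A Bud s) (p : Pos (tree d)) →
                 IsBud (sub (tree d) p) → Bud (label (sub (tree d) p))
    buds-valid (bud b) here _ = b
    buds-valid (by _ _ _) here (_ , ())
    buds-valid (by _ _ ds) (child i p) = buds-validₗ ds i p

    buds-validₗ : ∀ {ss} (ds : All (Derivation A Bud) ss) (i : Fin (length (trees ds)))
                  (p : Pos (lookup (trees ds) i)) →
                  IsBud (sub (lookup (trees ds) i) p) → Bud (label (sub (lookup (trees ds) i) p))
    buds-validₗ (d ∷ _) fzero p = buds-valid d p
    buds-validₗ (_ ∷ ds) (fsuc i) p = buds-validₗ ds i p

BudFree : Seq → Set
BudFree _ = ⊥

module _ {A : Inst → Set} where

  mutual
    tree-noBuds : ∀ {s} (d : Derivation A BudFree s) → NoBuds (tree d)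
    tree-noBuds (bud ())
    tree-noBuds (by _ _ ds) = trees-noBuds ds

    trees-noBuds : ∀ {ss} (ds : All (Derivation A BudFree) ss) → NoBudsL (trees ds)
    trees-noBuds [] = tt
    trees-noBuds (d ∷ ds) = tree-noBuds d , trees-noBuds ds

  derivation⇒GProof : ∀ {s} → Derivation A BudFree s → GProof A s
  derivation⇒GProof d = tree d , tree-wf d , tree-noBuds d , tree-≈ d

  mutual
    Derivation-map : ∀ {A' : Inst → Set} {Bud s} → (∀ {ι} → A ι → A' ι) →
                     Derivation A Bud s → Derivation A' Bud s
    Derivation-map f (bud b) = bud b
    Derivation-map f (by ι a {ok} ds) = by ι (f a) {ok} (Derivations-map f ds)

    Derivations-map : ∀ {A' : Inst → Set} {Bud ss} → (∀ {ι} → A ι → A' ι) →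
                      All (Derivation A Bud) ss → All (Derivation A' Bud) ss
    Derivations-map f [] = []
    Derivations-map f (d ∷ ds) = Derivation-map f d ∷ Derivations-map f ds

CompanionMap : PT → Set
CompanionMap t = (p : Pos t) → IsBud (sub t p) → Pos t

lookup-noBuds : ∀ ts → NoBudsL ts → ∀ i → NoBuds (lookup ts i)
lookup-noBuds (t ∷ ts) (nb , _) fzero = nb
lookup-noBuds (t ∷ ts) (_ , nbs) (fsuc i) = lookup-noBuds ts nbs i

sub-noBuds : ∀ {u} → NoBuds u → ∀ p → NoBuds (sub u p)
sub-noBuds nb here = nb
sub-noBuds {node _ _ ts} nb (child i p) = sub-noBuds (lookup-noBuds ts nb i) p

sub-extend : ∀ u p i → sub u (extend u p i) ≡ lookup (kids (sub u p)) i
sub-extend (node s ι ts) here i = refl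
sub-extend (node s ι ts) (child j p) i = sub-extend (lookup ts j) p i

inner-or-bud : ∀ u → IsInner u ⊎ IsBud u
inner-or-bud (bud s) = inj₂ (s , refl)
inner-or-bud (node s ι ts) = inj₁ (s , ι , ts , refl)

noBuds-¬IsBud : ∀ {u} → NoBuds u → ¬ IsBud u
noBuds-¬IsBud nb (_ , refl) = nb

sub-wf : ∀ {A u} → WF A u → ∀ p → WF A (sub u p)
sub-wf wf here = wf
sub-wf {u = node _ _ ts} (_ , _ , _ , wfs) (child i p) = sub-wf (lookup-wf ts wfs i) p
  where
  lookup-wf : ∀ {A} ts → WFs A ts → ∀ i → WF A (lookup ts i)
  lookup-wf (t ∷ ts) (wf , _) fzero = wf
  lookup-wf (t ∷ ts) (_ , wfs) (fsuc i) = lookup-wf ts wfs i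

mutual
  height : PT → ℕ
  height (bud _) = zero
  height (node _ _ ts) = suc (heights ts)

  heights : List PT → ℕ
  heights [] = zero
  heights (t ∷ ts) = height t ⊔ heights ts

lookup-height : ∀ ts i → height (lookup ts i) ≤ heights ts
lookup-height (t ∷ ts) fzero = m≤m⊔n (height t) (heights ts)
lookup-height (t ∷ ts) (fsuc i) = ≤-trans (lookup-height ts i) (m≤n⊔m (height t) (heights ts))

kid-descends : ∀ u → NoBuds u → ∀ i → NoBuds (lookup (kids u) i) × height (lookup (kids u) i) < height u
kid-descends (node _ _ ts) nb i = lookup-noBuds ts nb i , s≤s (lookup-height ts i)

Path : (t : PT) → CompanionMap t → (ℕ → Pos t) → (ℕ → ℕ) → Set
Path t C v j = ∀ i → Edge t C (v i) (j i) (v (suc i))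

module DerivationGraph (t : PT) (C : CompanionMap t) where

  edge-descends : ∀ {p j q} → NoBuds (sub t p) → Edge t C p j q →
                  NoBuds (sub t q) × height (sub t q) < height (sub t p)
  edge-descends {p} nb (i , _ , inj₁ (_ , refl)) rewrite sub-extend t p i = kid-descends (sub t p) nb i
  edge-descends {p} nb (i , _ , inj₂ (isBud , refl)) =
    ⊥-elim (noBuds-¬IsBud (subst NoBuds (sym (sub-extend t p i)) (proj₁ (kid-descends (sub t p) nb i))) isBud)

  budFree-¬Path : ∀ {v j} → Path t C v j → ∀ i → ¬ NoBuds (sub t (v i))
  budFree-¬Path {v} e i nb = descend (suc (height (sub t (v i)))) i nb ≤-refl
    where
    descend : ∀ n i → NoBuds (sub t (v i)) → height (sub t (v i)) < n → ⊥
    descend (suc n) i nb h< with edge-descends nb (e i)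
    ... | nb' , h<' = descend n (suc i) nb' (≤-trans h<' (≤-pred h<))

  bud-¬Edge : ∀ {p j q} → IsBud (sub t p) → ¬ Edge t C p j q
  bud-¬Edge (_ , eq) (i , _) with subst (λ u → Fin (length (kids u))) eq i
  ... | ()

  budFree⇒GlobalTrace : NoBuds t → GlobalTrace t C
  budFree⇒GlobalTrace nb v j e = ⊥-elim (budFree-¬Path e 0 (sub-noBuds nb (v 0)))

  record CycleTrace : Set₁ where
    field
      OnCycle  : Pos t → Set
      classify : ∀ p → OnCycle p ⊎ NoBuds (sub t p) ⊎ IsBud (sub t p)
      trace    : ∀ {p} → OnCycle p → Fm
      rank     : ∀ {p} → OnCycle p → ℕ
      step     : ∀ {p j q} (c : OnCycle p) → Edge t C p j q → (c' : OnCycle q) →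
                 (trace c ∈ proj₂ (label (sub t p))) × TStepAt (sub t p) j (trace c) (trace c') ×
                 (rank c' < rank c ⊎ ProgressAt (sub t p) j (trace c) (trace c'))

  cycleTrace⇒GlobalTrace : CycleTrace → GlobalTrace t C
  cycleTrace⇒GlobalTrace ct v j e = 0 , τ , (λ i _ → proj₁ (step′ i) , proj₁ (proj₂ (step′ i))) , progress
    where
    open CycleTrace ct

    onCycle : ∀ i → OnCycle (v i)
    onCycle i with classify (v i)
    ... | inj₁ c = c
    ... | inj₂ (inj₁ nb) = ⊥-elim (budFree-¬Path e i nb)
    ... | inj₂ (inj₂ b) = ⊥-elim (bud-¬Edge b (e i))

    τ : ℕ → Fm
    τ i = trace (onCycle i)

    step′ : ∀ i → (τ i ∈ proj₂ (label (sub t (v i)))) × TStepAt (sub t (v i)) (j i) (τ i) (τ (suc i)) ×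
                  (rank (onCycle (suc i)) < rank (onCycle i) ⊎ ProgressAt (sub t (v i)) (j i) (τ i) (τ (suc i)))
    step′ i = step (onCycle i) (e i) (onCycle (suc i))

    progress-within : ∀ n m → rank (onCycle m) ≤ n →
                      Σ ℕ λ i → m ≤ i × ProgressAt (sub t (v i)) (j i) (τ i) (τ (suc i))
    progress-within n m r≤n with proj₂ (proj₂ (step′ m))
    ... | inj₂ pr = m , ≤-refl , pr
    progress-within zero m r≤n | inj₁ r< with ≤-trans r< r≤n
    ... | ()
    progress-within (suc n) m r≤n | inj₁ r< with progress-within n (suc m) (≤-pred (≤-trans r< r≤n))
    ... | i , m<i , pr = i , ≤-trans (n≤1+n m) m<i , pr

    progress : ∀ m → Σ ℕ λ i → m ≤ i × 0 ≤ i × ProgressAt (sub t (v i)) (j i) (τ i) (τ (suc i))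
    progress m with progress-within (rank (onCycle m)) m ≤-refl
    ... | i , m≤i , pr = i , m≤i , z≤n , pr

derivation⇒CProof : ∀ {A s} → Derivation A BudFree s → CProof A s
derivation⇒CProof d =
  tree d , tree-wf d , tree-≈ d ,
  (noCompanion , λ p b → ⊥-elim (noBud p b)) , budFree⇒GlobalTrace (tree-noBuds d)
  where
  noBud : ∀ p → ¬ IsBud (sub (tree d) p)
  noBud p = noBuds-¬IsBud (sub-noBuds (tree-noBuds d) p)

  noCompanion : CompanionMap (tree d)
  noCompanion p b = ⊥-elim (noBud p b)

  open DerivationGraph (tree d) noCompanion using (budFree⇒GlobalTrace)

toRoot : ∀ {t} → CompanionMap t
toRoot _ _ = here

cyclicDerivation⇒CProof : ∀ {A s} (d : Derivation A (s ≈S_) s) → IsInner (tree d) →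
                          GlobalTrace (tree d) toRoot → CProof A s
cyclicDerivation⇒CProof d inner gt =
  tree d , tree-wf d , tree-≈ d , (toRoot , λ p b → inner , root≈bud p b) , gt
  where
  root≈bud : ∀ p → IsBud (sub (tree d) p) → label (tree d) ≈S label (sub (tree d) p)
  root≈bud p b = subst (_≈S label (sub (tree d) p)) (sym (tree-label d)) (buds-valid d p b)

zip-All-Any : ∀ {A : Set} {P Q : A → Set} {xs} → All P xs → Any Q xs → Any (λ x → P x × Q x) xs
zip-All-Any (px ∷ _) (here qx) = here (px , qx)
zip-All-Any (_ ∷ pxs) (there qxs) = there (zip-All-Any pxs qxs)

NoProgress : Inst → Set
NoProgress ι = ∀ j τ τ' → ¬ Progress ι j τ τ'

NoProgressAt : PT → ℕ → Set
NoProgressAt u j = ∀ τ τ' → ¬ ProgressAt u j τ τ'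

module Invariant {A : Inst → Set} {P : Seq → Set} (P-resp : P Respects _≈S_) where

  P-children : ∀ {ι ts} → Pointwise _≈S_ (map label ts) (prems ι) → Any P (prems ι) → Any (P ∘ label) ts
  P-children pw = Any.map⁻ ∘ Pointwise.Any-resp-Pointwise P-resp (Pointwise.symmetric ≈S-sym pw)

  module _ (step : ∀ ι → A ι → P (concl ι) → Any P (prems ι)) where

    mutual
      ¬tree : ∀ t → WF A t → NoBuds t → ¬ P (label t)
      ¬tree (node s ι ts) (a , s≈ , pw , wfs) nb Ps = ¬trees ts wfs nb (P-children pw (step ι a (P-resp s≈ Ps)))

      ¬trees : ∀ ts → WFs A ts → NoBudsL ts → ¬ Any (P ∘ label) ts
      ¬trees (t ∷ _) (wf , _) (nb , _) (here Pt) = ¬tree t wf nb Pt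
      ¬trees (_ ∷ ts) (_ , wfs) (_ , nbs) (there Pts) = ¬trees ts wfs nbs Pts

    invariant⇒¬GProof : ∀ {s} → P s → ¬ GProof A s
    invariant⇒¬GProof Ps (t , wf , nb , t≈s) = ¬tree t wf nb (P-resp (≈S-sym t≈s) Ps)

  module _ (step : ∀ ι → A ι → P (concl ι) → Any P (prems ι) × NoProgress ι) where

    P-child : ∀ u → WF A u → IsInner u → P (label u) →
              Σ (Fin (length (kids u))) λ i → P (label (lookup (kids u) i)) × NoProgressAt u (toℕ i)
    P-child (node s ι ts) (a , s≈ , pw , _) _ Ps with step ι a (P-resp s≈ Ps)
    ... | Pprems , noProgress = Any.index Pts , Any.lookup-index Pts , noProgress _
      where
      Pts : Any (P ∘ label) ts
      Pts = P-children pw Pprems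

    progress-free-path : ∀ {t} → WF A t → (C : Companion t) → P (label t) →
      Σ (ℕ → Pos t) λ v → Σ (ℕ → ℕ) λ j → Path t (proj₁ C) v j × (∀ n → NoProgressAt (sub t (v n)) (j n))
    progress-free-path {t} wf (C , C-valid) Pt = v , j , edges , noProgress
      where
      Good : Pos t → Set
      Good p = IsInner (sub t p) × P (label (sub t p))

      Arrival : Pos t → Pos t → Set
      Arrival q q' = (IsInner (sub t q) × q' ≡ q) ⊎ (Σ (IsBud (sub t q)) λ b → q' ≡ C q b)

      arrive : ∀ q → P (label (sub t q)) → Σ (Pos t) λ q' → Good q' × Arrival q q'
      arrive q Pq with inner-or-bud (sub t q)
      ... | inj₁ inner = q , (inner , Pq) , inj₁ (inner , refl)
      ... | inj₂ b = C q b , (proj₁ (C-valid q b) , P-resp (≈S-sym (proj₂ (C-valid q b))) Pq) , inj₂ (b , refl)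

      next : ∀ p → Good p → Σ ℕ λ j → Σ (Pos t) λ q →
             Good q × Edge t C p j q × NoProgressAt (sub t p) j
      next p (inner , Pp) with P-child (sub t p) (sub-wf wf p) inner Pp
      ... | i , Pi , noProgress with arrive (extend t p i) (subst (P ∘ label) (sym (sub-extend t p i)) Pi)
      ... | q , good , arrival = toℕ i , q , good , (i , refl , arrival) , noProgress

      walk : ℕ → Σ (Pos t) Good
      walk zero = let (q , good , _) = arrive here Pt in q , good
      walk (suc n) = let (_ , q , good , _) = next (proj₁ (walk n)) (proj₂ (walk n)) in q , good

      v : ℕ → Pos t
      v n = proj₁ (walk n)

      j : ℕ → ℕ
      j n = proj₁ (next (v n) (proj₂ (walk n)))

      edges : Path t C v j
      edges n = let (_ , _ , _ , edge , _) = next (v n) (proj₂ (walk n)) in edge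

      noProgress : ∀ n → NoProgressAt (sub t (v n)) (j n)
      noProgress n = let (_ , _ , _ , _ , np) = next (v n) (proj₂ (walk n)) in np

    invariant⇒¬CProof : ∀ {s} → P s → ¬ CProof A s
    invariant⇒¬CProof Ps (t , wf , t≈s , C , gt) with progress-free-path wf C (P-resp (≈S-sym t≈s) Ps)
    ... | v , j , edges , noProgress with gt v j edges
    ... | _ , τ , _ , progress with progress 0
    ... | i , _ , _ , pr = noProgress i (τ i) (τ (suc i)) pr

mutual
  StarFree : Fm → Set
  StarFree ⊥' = ⊤
  StarFree (var _) = ⊤
  StarFree (φ ⇒ ψ) = StarFree φ × StarFree ψ
  StarFree (box π φ) = StarFreeᵖ π × StarFree φ
  StarFree (bbox π φ) = StarFreeᵖ π × StarFree φ

  StarFreeᵖ : Pg → Set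
  StarFreeᵖ (atom _) = ⊤
  StarFreeᵖ (π₀ ⨾ π₁) = StarFreeᵖ π₀ × StarFreeᵖ π₁
  StarFreeᵖ (π₀ ∪ π₁) = StarFreeᵖ π₀ × StarFreeᵖ π₁
  StarFreeᵖ (star _) = ⊥
  StarFreeᵖ (test φ) = StarFree φ

starFree-step : ∀ ι → notCut ι → Sides StarFree StarFree (concl ι) →
                All (Sides StarFree StarFree) (prems ι) × NoProgress ι
starFree-step (ax Γ Δ φ) _ _ = [] , λ _ _ _ ()
starFree-step (botL Γ Δ) _ _ = [] , λ _ _ _ ()
starFree-step (impL Γ Δ φ ψ) _ ((φ' , ψ') ∷ sΓ , sΔ) = (sΓ , φ' ∷ sΔ) ∷ (ψ' ∷ sΓ , sΔ) ∷ [] , λ _ _ _ ()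
starFree-step (impR Γ Δ φ ψ) _ (sΓ , (φ' , ψ') ∷ sΔ) = (φ' ∷ sΓ , ψ' ∷ sΔ) ∷ [] , λ _ _ _ ()
starFree-step (wk Γ Δ Γ' Δ' Γ⊆ Δ⊆) _ sides = Sides-⊇ˢ (Γ⊆ , Δ⊆) sides ∷ [] , λ _ _ _ ()
starFree-step (boxR π Γ φ Δ) _ (sΓ , (π' , φ') ∷ sΔ) =
  (All.gmap⁻ proj₂ sΓ , φ' ∷ All.gmap⁺ (π' ,_) sΔ) ∷ [] , λ _ _ _ ()
starFree-step (bboxR π Γ φ Δ) _ (sΓ , (π' , φ') ∷ sΔ) =
  (All.gmap⁻ proj₂ sΓ , φ' ∷ All.gmap⁺ (π' ,_) sΔ) ∷ [] , λ _ _ _ ()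
starFree-step (seqL π₀ π₁ φ Γ Δ) _ (((π₀' , π₁') , φ') ∷ sΓ , sΔ) =
  ((π₀' , π₁' , φ') ∷ sΓ , sΔ) ∷ [] , λ _ _ _ ()
starFree-step (seqR π₀ π₁ φ Γ Δ) _ (sΓ , ((π₀' , π₁') , φ') ∷ sΔ) =
  (sΓ , (π₀' , π₁' , φ') ∷ sΔ) ∷ [] , λ _ _ _ ()
starFree-step (cupL π₀ π₁ φ Γ Δ) _ (((π₀' , π₁') , φ') ∷ sΓ , sΔ) =
  ((π₀' , φ') ∷ (π₁' , φ') ∷ sΓ , sΔ) ∷ [] , λ _ _ _ ()
starFree-step (cupR π₀ π₁ φ Γ Δ) _ (sΓ , ((π₀' , π₁') , φ') ∷ sΔ) =
  (sΓ , (π₀' , φ') ∷ sΔ) ∷ (sΓ , (π₁' , φ') ∷ sΔ) ∷ [] , λ _ _ _ ()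
starFree-step (starL π φ Γ Δ) _ ((() , _) ∷ _ , _)
starFree-step (testL φ ψ Γ Δ) _ ((φ' , ψ') ∷ sΓ , sΔ) = (sΓ , φ' ∷ sΔ) ∷ (ψ' ∷ sΓ , sΔ) ∷ [] , λ _ _ _ ()
starFree-step (testR φ ψ Γ Δ) _ (sΓ , (φ' , ψ') ∷ sΔ) = (φ' ∷ sΓ , ψ' ∷ sΔ) ∷ [] , λ _ _ _ ()
starFree-step (starR π Γ φ) _ (_ , (() , _) ∷ _)
starFree-step (cs π φ Γ Δ) _ (_ , (() , _) ∷ _)

data World : Set where
  w₀ w₁ : World

_==ʷ_ : World → World → Bool
w₀ ==ʷ w₀ = true
w₁ ==ʷ w₁ = true
_ ==ʷ _ = false

==ʷ-refl : ∀ w → (w ==ʷ w) ≡ true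
==ʷ-refl w₀ = refl
==ʷ-refl w₁ = refl

==ʷ-sound : ∀ w u → (w ==ʷ u) ≡ true → w ≡ u
==ʷ-sound w₀ w₀ _ = refl
==ʷ-sound w₁ w₁ _ = refl

_⇒ᵇ_ : Bool → Bool → Bool
a ⇒ᵇ b = not a ∨ b

⇒ᵇ-elim : ∀ {a b} → (a ⇒ᵇ b) ≡ true → a ≡ true → b ≡ true
⇒ᵇ-elim a⇒b refl = a⇒b

⇒ᵇ-intro : ∀ a {b} → (a ≡ true → b ≡ true) → (a ⇒ᵇ b) ≡ true
⇒ᵇ-intro true f = f refl
⇒ᵇ-intro false f = refl

⇒ᵇ-false : ∀ a {b} → (a ⇒ᵇ b) ≡ false → a ≡ true × b ≡ false
⇒ᵇ-false true b≡false = refl , b≡false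

∨-elim : ∀ a {b} → (a ∨ b) ≡ true → a ≡ true ⊎ b ≡ true
∨-elim true _ = inj₁ refl
∨-elim false b = inj₂ b

∨-introˡ : ∀ {a} b → a ≡ true → (a ∨ b) ≡ true
∨-introˡ _ refl = refl

∨-introʳ : ∀ a {b} → b ≡ true → (a ∨ b) ≡ true
∨-introʳ true _ = refl
∨-introʳ false b = b

∧-elim : ∀ a {b} → (a ∧ b) ≡ true → a ≡ true × b ≡ true
∧-elim true b = refl , b

every : (World → Bool) → Bool
every f = f w₀ ∧ f w₁

some : (World → Bool) → Bool
some f = f w₀ ∨ f w₁

-- Opaque so that ρ and f can be inferred by unification from a goal  □ ρ f w ≡ b.
opaque
  □ : (World → World → Bool) → (World → Bool) → World → Bool
  □ ρ f w = every λ v → ρ w v ⇒ᵇ f v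

module _ {ρ : World → World → Bool} {f : World → Bool} where

  opaque
    unfolding □
    □-unfold : ∀ w → □ ρ f w ≡ every (λ v → ρ w v ⇒ᵇ f v)
    □-unfold w = refl

  □-elim : ∀ {w} → □ ρ f w ≡ true → ∀ {v} → ρ w v ≡ true → f v ≡ true
  □-elim {w} □f {w₀} rewrite □-unfold w = ⇒ᵇ-elim (proj₁ (∧-elim (ρ w w₀ ⇒ᵇ f w₀) □f))
  □-elim {w} □f {w₁} rewrite □-unfold w = ⇒ᵇ-elim (proj₂ (∧-elim (ρ w w₀ ⇒ᵇ f w₀) □f))

  □-intro : ∀ {w} → (∀ v → ρ w v ≡ true → f v ≡ true) → □ ρ f w ≡ true
  □-intro {w} g rewrite □-unfold w | ⇒ᵇ-intro (ρ w w₀) (g w₀) | ⇒ᵇ-intro (ρ w w₁) (g w₁) = refl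

  □-counter : ∀ {w} → □ ρ f w ≡ false → ∃ λ v → ρ w v ≡ true × f v ≡ false
  □-counter {w} □f rewrite □-unfold w with ρ w w₀ ⇒ᵇ f w₀ in at₀
  ... | false = w₀ , ⇒ᵇ-false (ρ w w₀) at₀
  ... | true = w₁ , ⇒ᵇ-false (ρ w w₁) □f

  □-refute : ∀ {w v} → ρ w v ≡ true → f v ≡ false → □ ρ f w ≡ false
  □-refute {w} {w₀} ρwv fv rewrite □-unfold w | ρwv | fv = refl
  □-refute {w} {w₁} ρwv fv rewrite □-unfold w | ρwv | fv = ∧-zeroʳ (ρ w w₀ ⇒ᵇ f w₀)

module Kripke₂ (R : ℕ → World → World → Bool) (V : ℕ → World → Bool) where

  mutual
    ⟦_⟧ : Fm → World → Bool
    ⟦ ⊥' ⟧ w = false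
    ⟦ var n ⟧ w = V n w
    ⟦ φ ⇒ ψ ⟧ w = ⟦ φ ⟧ w ⇒ᵇ ⟦ ψ ⟧ w
    ⟦ box π φ ⟧ w = □ ⟦ π ⟧ᵖ ⟦ φ ⟧ w
    ⟦ bbox π φ ⟧ w = □ (flip ⟦ π ⟧ᵖ) ⟦ φ ⟧ w

    ⟦_⟧ᵖ : Pg → World → World → Bool
    ⟦ atom a ⟧ᵖ w u = R a w u
    ⟦ π₀ ⨾ π₁ ⟧ᵖ w u = some λ v → ⟦ π₀ ⟧ᵖ w v ∧ ⟦ π₁ ⟧ᵖ v u
    ⟦ π₀ ∪ π₁ ⟧ᵖ w u = ⟦ π₀ ⟧ᵖ w u ∨ ⟦ π₁ ⟧ᵖ w u
    ⟦ star π ⟧ᵖ w u = (w ==ʷ u) ∨ ⟦ π ⟧ᵖ w u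
    ⟦ test φ ⟧ᵖ w u = (w ==ʷ u) ∧ ⟦ φ ⟧ w

  ⨾-intro : ∀ π₀ π₁ {w v u} → ⟦ π₀ ⟧ᵖ w v ≡ true → ⟦ π₁ ⟧ᵖ v u ≡ true → ⟦ π₀ ⨾ π₁ ⟧ᵖ w u ≡ true
  ⨾-intro π₀ π₁ {v = w₀} r₀ r₁ rewrite r₀ | r₁ = refl
  ⨾-intro π₀ π₁ {w} {w₁} {u} r₀ r₁ rewrite r₀ | r₁ = ∨-introʳ (⟦ π₀ ⟧ᵖ w w₀ ∧ ⟦ π₁ ⟧ᵖ w₀ u) refl

  ⨾-elim : ∀ π₀ π₁ {w u} → ⟦ π₀ ⨾ π₁ ⟧ᵖ w u ≡ true → ∃ λ v → ⟦ π₀ ⟧ᵖ w v ≡ true × ⟦ π₁ ⟧ᵖ v u ≡ true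
  ⨾-elim π₀ π₁ {w} {u} r with ∨-elim (⟦ π₀ ⟧ᵖ w w₀ ∧ ⟦ π₁ ⟧ᵖ w₀ u) r
  ... | inj₁ via₀ = w₀ , ∧-elim (⟦ π₀ ⟧ᵖ w w₀) via₀
  ... | inj₂ via₁ = w₁ , ∧-elim (⟦ π₀ ⟧ᵖ w w₁) via₁

  *-refl : ∀ π w → ⟦ star π ⟧ᵖ w w ≡ true
  *-refl π w = ∨-introˡ (⟦ π ⟧ᵖ w w) (==ʷ-refl w)

  *-step : ∀ π {w u} → ⟦ π ⟧ᵖ w u ≡ true → ⟦ star π ⟧ᵖ w u ≡ true
  *-step π {w} {u} = ∨-introʳ (w ==ʷ u)

  *-elim : ∀ π {w u} → ⟦ star π ⟧ᵖ w u ≡ true → w ≡ u ⊎ ⟦ π ⟧ᵖ w u ≡ true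
  *-elim π {w} {u} r with ∨-elim (w ==ʷ u) r
  ... | inj₁ w≡u = inj₁ (==ʷ-sound w u w≡u)
  ... | inj₂ step = inj₂ step

  -- With only two worlds, a π-path w → v → u either returns to w or contains a
  -- π-step from w to u; this is why "reflexive or π" already is the
  -- reflexive–transitive closure of π.
  *-trans₂ : ∀ π w v u → ⟦ π ⟧ᵖ w v ≡ true → ⟦ π ⟧ᵖ v u ≡ true → ⟦ star π ⟧ᵖ w u ≡ true
  *-trans₂ π w₀ w₀ u _ r = *-step π r
  *-trans₂ π w₁ w₁ u _ r = *-step π r
  *-trans₂ π w₀ w₁ w₁ r _ = *-step π r
  *-trans₂ π w₁ w₀ w₀ r _ = *-step π r
  *-trans₂ π w₀ w₁ w₀ _ _ = *-refl π w₀
  *-trans₂ π w₁ w₀ w₁ _ _ = *-refl π w₁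

  *-trans : ∀ π {w v u} → ⟦ π ⟧ᵖ w v ≡ true → ⟦ star π ⟧ᵖ v u ≡ true → ⟦ star π ⟧ᵖ w u ≡ true
  *-trans π {w} {v} {u} r r* with *-elim π r*
  ... | inj₁ refl = *-step π r
  ... | inj₂ r′ = *-trans₂ π w v u r r′

  ?-intro : ∀ φ {w} → ⟦ φ ⟧ w ≡ true → ⟦ test φ ⟧ᵖ w w ≡ true
  ?-intro φ {w} φw rewrite ==ʷ-refl w = φw

  ?-elim : ∀ φ {w u} → ⟦ test φ ⟧ᵖ w u ≡ true → w ≡ u × ⟦ φ ⟧ w ≡ true
  ?-elim φ {w} {u} r with ∧-elim (w ==ʷ u) r
  ... | w≡u , φw = ==ʷ-sound w u w≡u , φw

  Refutes : World → Seq → Set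
  Refutes w = Sides (λ φ → ⟦ φ ⟧ w ≡ true) (λ φ → ⟦ φ ⟧ w ≡ false)

  Refutable : Seq → Set
  Refutable s = ∃ λ w → Refutes w s

  rule-sound : ∀ ι → Refutable (concl ι) → Any Refutable (prems ι)
  rule-sound (ax Γ Δ φ) (w , φtrue ∷ _ , φfalse ∷ _) with () ← trans (sym φtrue) φfalse
  rule-sound (botL Γ Δ) (w , () ∷ _ , _)
  rule-sound (impL Γ Δ φ ψ) (w , φ⇒ψ ∷ hΓ , hΔ) with ⟦ φ ⟧ w in φw
  ... | false = here (w , hΓ , φw ∷ hΔ)
  ... | true = there (here (w , φ⇒ψ ∷ hΓ , hΔ))
  rule-sound (impR Γ Δ φ ψ) (w , hΓ , φ⇒ψ ∷ hΔ) =
    let φtrue , ψfalse = ⇒ᵇ-false (⟦ φ ⟧ w) φ⇒ψ in here (w , φtrue ∷ hΓ , ψfalse ∷ hΔ)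
  rule-sound (wk Γ Δ Γ' Δ' Γ⊆ Δ⊆) (w , refuted) = here (w , Sides-⊇ˢ (Γ⊆ , Δ⊆) refuted)
  rule-sound (cut Γ Δ φ) (w , hΓ , hΔ) with ⟦ φ ⟧ w in φw
  ... | false = here (w , hΓ , φw ∷ hΔ)
  ... | true = there (here (w , φw ∷ hΓ , hΔ))
  rule-sound (boxR π Γ φ Δ) (w , hΓ , □φ ∷ hΔ) =
    let v , wv , φv = □-counter □φ
    in here (v , All.map (λ □γ → □-elim □γ wv) (All.map⁻ hΓ) , φv ∷ All.map⁺ (All.map (□-refute wv) hΔ))
  rule-sound (bboxR π Γ φ Δ) (w , hΓ , ■φ ∷ hΔ) =
    let v , vw , φv = □-counter ■φ
    in here (v , All.map (λ ■γ → □-elim ■γ vw) (All.map⁻ hΓ) , φv ∷ All.map⁺ (All.map (□-refute vw) hΔ))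
  rule-sound (seqL π₀ π₁ φ Γ Δ) (w , □φ ∷ hΓ , hΔ) =
    here (w , □-intro (λ v wv → □-intro (λ u vu → □-elim □φ (⨾-intro π₀ π₁ wv vu))) ∷ hΓ , hΔ)
  rule-sound (seqR π₀ π₁ φ Γ Δ) (w , hΓ , □φ ∷ hΔ) =
    let u , wu , φu = □-counter □φ
        v , wv , vu = ⨾-elim π₀ π₁ {w} {u} wu
    in here (w , hΓ , □-refute wv (□-refute vu φu) ∷ hΔ)
  rule-sound (cupL π₀ π₁ φ Γ Δ) (w , □φ ∷ hΓ , hΔ) =
    here (w , □-intro (λ v wv → □-elim □φ (∨-introˡ (⟦ π₁ ⟧ᵖ w v) wv))
            ∷ □-intro (λ v wv → □-elim □φ (∨-introʳ (⟦ π₀ ⟧ᵖ w v) wv)) ∷ hΓ , hΔ)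
  rule-sound (cupR π₀ π₁ φ Γ Δ) (w , hΓ , □φ ∷ hΔ) with □-counter □φ
  ... | v , wv , φv with ∨-elim (⟦ π₀ ⟧ᵖ w v) wv
  ... | inj₁ wv₀ = here (w , hΓ , □-refute wv₀ φv ∷ hΔ)
  ... | inj₂ wv₁ = there (here (w , hΓ , □-refute wv₁ φv ∷ hΔ))
  rule-sound (starL π φ Γ Δ) (w , □φ ∷ hΓ , hΔ) =
    here (w , □-elim □φ (*-refl π w)
            ∷ □-intro (λ v wv → □-intro (λ u vu → □-elim □φ (*-trans π wv vu))) ∷ hΓ , hΔ)
  rule-sound (testL φ ψ Γ Δ) (w , □ψ ∷ hΓ , hΔ) with ⟦ φ ⟧ w in φw
  ... | false = here (w , hΓ , φw ∷ hΔ)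
  ... | true = there (here (w , □-elim □ψ (?-intro φ φw) ∷ hΓ , hΔ))
  rule-sound (testR φ ψ Γ Δ) (w , hΓ , □ψ ∷ hΔ) with □-counter □ψ
  ... | v , wv , ψv with ?-elim φ {w} {v} wv
  ... | refl , φw = here (w , φw ∷ hΓ , ψv ∷ hΔ)
  rule-sound (starR π Γ φ) (w , φw ∷ hΓ , □φ ∷ []) with □-counter □φ
  ... | v , wv , φv with *-elim π {w} {v} wv
  ... | inj₁ refl with () ← trans (sym φw) φv
  ... | inj₂ step =
    here (w , φw ∷ All.map (λ □γ → □-elim □γ (*-refl π w)) (All.map⁻ hΓ) , □-refute step φv ∷ [])
  rule-sound (cs π φ Γ Δ) (w , hΓ , □φ ∷ hΔ) with □-counter □φ
  ... | v , wv , φv with *-elim π {w} {v} wv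
  ... | inj₁ refl = here (w , hΓ , φv ∷ hΔ)
  ... | inj₂ step = there (here (w , hΓ , □-refute step (□-refute (*-refl π v) φv) ∷ hΔ))

  Refutable-⊇ˢ : ∀ {s s'} → s' ⊆ˢ s → Refutable s → Refutable s'
  Refutable-⊇ˢ s'⊆s (w , refuted) = w , Sides-⊇ˢ s'⊆s refuted

model-R : ℕ → World → World → Bool
model-R _ _ w₀ = false
model-R _ _ w₁ = true

model-V : ℕ → World → Bool
model-V 0 w₀ = true
model-V _ _ = false

open Kripke₂ model-R model-V

α : Pg
α = atom 0

α* : Pg
α* = star α

~_ : Fm → Fm
~ φ = φ ⇒ ⊥'

~-false : ∀ φ {w} → ⟦ φ ⟧ w ≡ true → ⟦ ~ φ ⟧ w ≡ false
~-false φ φw rewrite φw = refl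

module Part1 where

  p q : Fm
  p = var 0
  q = var 1

  preserve yield : Fm
  preserve = q ⇒ box α q
  yield = q ⇒ p

  S₁ : Seq
  S₁ = q ∷ box α* preserve ∷ box α* yield ∷ [] , box α* p ∷ []

  data Left₁ : Fm → Set where
    L-q          : Left₁ q
    L-p          : Left₁ p
    L-preserve   : Left₁ preserve
    L-yield      : Left₁ yield
    L-αq         : Left₁ (box α q)
    L-*preserve  : Left₁ (box α* preserve)
    L-*yield     : Left₁ (box α* yield)
    L-α*preserve : Left₁ (box α (box α* preserve))
    L-α*yield    : Left₁ (box α (box α* yield))

  data Right₁ : Fm → Set where
    R-*p  : Right₁ (box α* p)
    R-α*p : Right₁ (box α (box α* p))
    R-←   : ∀ {φ} → Right₁ φ → Right₁ (bbox α φ)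

  Left₁∩Right₁-empty : ∀ {φ} → Left₁ φ → ¬ Right₁ φ
  Left₁∩Right₁-empty L-q ()
  Left₁∩Right₁-empty L-p ()
  Left₁∩Right₁-empty L-preserve ()
  Left₁∩Right₁-empty L-yield ()
  Left₁∩Right₁-empty L-αq ()
  Left₁∩Right₁-empty L-*preserve ()
  Left₁∩Right₁-empty L-*yield ()
  Left₁∩Right₁-empty L-α*preserve ()
  Left₁∩Right₁-empty L-α*yield ()

  Class₁ : Fm → Set
  Class₁ φ = Left₁ φ ⊎ Right₁ φ

  FL-Left₁ : ∀ {φ} → Left₁ φ → All Left₁ (FL φ)
  FL-Left₁ L-q = L-q ∷ []
  FL-Left₁ L-p = L-p ∷ []
  FL-Left₁ L-preserve = L-preserve ∷ L-q ∷ L-αq ∷ L-q ∷ []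
  FL-Left₁ L-yield = L-yield ∷ L-q ∷ L-p ∷ []
  FL-Left₁ L-αq = L-αq ∷ L-q ∷ []
  FL-Left₁ L-*preserve = L-*preserve ∷ L-α*preserve ∷ FL-Left₁ L-preserve
  FL-Left₁ L-*yield = L-*yield ∷ L-α*yield ∷ FL-Left₁ L-yield
  FL-Left₁ L-α*preserve = L-α*preserve ∷ L-*preserve ∷ L-α*preserve ∷ FL-Left₁ L-preserve
  FL-Left₁ L-α*yield = L-α*yield ∷ L-*yield ∷ L-α*yield ∷ FL-Left₁ L-yield

  FL-Right₁ : ∀ {φ} → Right₁ φ → All Class₁ (FL φ)
  FL-Right₁ R-*p = inj₂ R-*p ∷ inj₂ R-α*p ∷ inj₁ L-p ∷ []
  FL-Right₁ R-α*p = inj₂ R-α*p ∷ inj₂ R-*p ∷ inj₂ R-α*p ∷ inj₁ L-p ∷ []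
  FL-Right₁ (R-← right) = inj₂ (R-← right) ∷ FL-Right₁ right

  FL-Class₁ : ∀ {φ} → Class₁ φ → All Class₁ (FL φ)
  FL-Class₁ (inj₁ left) = All.map inj₁ (FL-Left₁ left)
  FL-Class₁ (inj₂ right) = FL-Right₁ right

  FLs-Class₁ : ∀ {Γ Δ} → Sides Left₁ Right₁ (Γ , Δ) → All Class₁ (FLs (Γ ++ Δ))
  FLs-Class₁ (ls , rs) = All.concat⁺ (All.map⁺ (All.map FL-Class₁ (All.++⁺ (All.map inj₁ ls) (All.map inj₂ rs))))

  starred-holds : ∀ {φ} → Left₁ (box α* φ) → ∀ w → ⟦ φ ⟧ w ≡ true
  starred-holds L-*preserve w₀ = refl
  starred-holds L-*preserve w₁ = refl
  starred-holds L-*yield w₀ = refl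
  starred-holds L-*yield w₁ = refl

  Right₁-fails : ∀ {φ} → Right₁ φ → ⟦ φ ⟧ w₁ ≡ false
  Right₁-fails R-*p = □-refute {v = w₁} (*-refl α w₁) refl
  Right₁-fails R-α*p = □-refute {v = w₁} refl (Right₁-fails R-*p)
  Right₁-fails (R-← right) = □-refute {v = w₁} refl (Right₁-fails right)

  unbox-α : ∀ {φ} → Left₁ (box α φ) → Left₁ φ
  unbox-α L-αq = L-q
  unbox-α L-α*preserve = L-*preserve
  unbox-α L-α*yield = L-*yield

  Inv₁ : Seq → Set
  Inv₁ s = Sides Left₁ Right₁ s ⊎ Refutable s

  Inv₁-resp : Inv₁ Respects _≈S_
  Inv₁-resp s≈s' (inj₁ inside) = inj₁ (Sides-resp s≈s' inside)
  Inv₁-resp s≈s' (inj₂ refutable) = inj₂ (Refutable-⊇ˢ (≈S⇒⊇ˢ s≈s') refutable)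

  inside₁-step : ∀ ι → isG ι → notCut ι ⊎ flCutOK ι → Sides Left₁ Right₁ (concl ι) → Any Inv₁ (prems ι)
  inside₁-step (ax Γ Δ φ) _ _ (left ∷ _ , right ∷ _) = ⊥-elim (Left₁∩Right₁-empty left right)
  inside₁-step (botL Γ Δ) _ _ (() ∷ _ , _)
  inside₁-step (impL Γ Δ φ ψ) _ _ (L-preserve ∷ ls , rs) = there (here (inj₁ (L-αq ∷ ls , rs)))
  inside₁-step (impL Γ Δ φ ψ) _ _ (L-yield ∷ ls , rs) = there (here (inj₁ (L-p ∷ ls , rs)))
  inside₁-step (impR Γ Δ φ ψ) _ _ (_ , () ∷ _)
  inside₁-step (wk Γ Δ Γ' Δ' Γ⊆ Δ⊆) _ _ inside = here (inj₁ (Sides-⊇ˢ (Γ⊆ , Δ⊆) inside))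
  inside₁-step (cut Γ Δ φ) _ (inj₂ φ∈FL) (ls , rs) with All.lookup (FLs-Class₁ (ls , rs)) φ∈FL
  ... | inj₁ left = there (here (inj₁ (left ∷ ls , rs)))
  ... | inj₂ right = here (inj₁ (ls , right ∷ rs))
  inside₁-step (boxR π Γ φ Δ) _ _ (ls , R-*p ∷ rs) =
    here (inj₂ (w₁ , All.map (λ left → starred-holds left w₁) (All.map⁻ ls) , refl
                   ∷ All.map⁺ (All.map (λ right → □-refute (*-refl α w₁) (Right₁-fails right)) rs)))
  inside₁-step (boxR π Γ φ Δ) _ _ (ls , R-α*p ∷ rs) =
    here (inj₁ (All.gmap⁻ unbox-α ls , R-*p ∷ All.gmap⁺ R-← rs))
  inside₁-step (bboxR π Γ φ Δ) _ _ (ls , R-← right ∷ rs) =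
    here (inj₂ (w₁ , All.gmap⁻ (λ ()) ls , Right₁-fails right
                   ∷ All.map⁺ (All.map (λ right → □-refute {v = w₁} refl (Right₁-fails right)) rs)))
  inside₁-step (seqL π₀ π₁ φ Γ Δ) _ _ (() ∷ _ , _)
  inside₁-step (seqR π₀ π₁ φ Γ Δ) _ _ (_ , () ∷ _)
  inside₁-step (cupL π₀ π₁ φ Γ Δ) _ _ (() ∷ _ , _)
  inside₁-step (cupR π₀ π₁ φ Γ Δ) _ _ (_ , () ∷ _)
  inside₁-step (starL π φ Γ Δ) _ _ (L-*preserve ∷ ls , rs) = here (inj₁ (L-preserve ∷ L-α*preserve ∷ ls , rs))
  inside₁-step (starL π φ Γ Δ) _ _ (L-*yield ∷ ls , rs) = here (inj₁ (L-yield ∷ L-α*yield ∷ ls , rs))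
  inside₁-step (testL φ ψ Γ Δ) _ _ (() ∷ _ , _)
  inside₁-step (testR φ ψ Γ Δ) _ _ (_ , () ∷ _)
  inside₁-step (starR π Γ φ) _ _ (_ ∷ ls , R-*p ∷ []) =
    here (inj₂ (w₀ , refl ∷ All.map (λ left → starred-holds left w₀) (All.map⁻ ls) , □-refute {v = w₁} refl refl ∷ []))
  inside₁-step (cs π φ Γ Δ) () _ _

  Inv₁-step : ∀ ι → isG ι → notCut ι ⊎ flCutOK ι → Inv₁ (concl ι) → Any Inv₁ (prems ι)
  Inv₁-step ι g cutOK (inj₁ inside) = inside₁-step ι g cutOK inside
  Inv₁-step ι _ _ (inj₂ refutable) = Any.map inj₂ (rule-sound ι refutable)

  Inv₁-S₁ : Inv₁ S₁
  Inv₁-S₁ = inj₁ (L-q ∷ L-*preserve ∷ L-*yield ∷ [] , R-*p ∷ [])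

  S₁-not-FLCutG : ¬ FLCutProvG S₁
  S₁-not-FLCutG = Invariant.invariant⇒¬GProof Inv₁-resp (λ ι (g , fl) → Inv₁-step ι g (inj₂ fl)) Inv₁-S₁

  S₁-not-cutFreeG : ¬ CutFreeProvG S₁
  S₁-not-cutFreeG = Invariant.invariant⇒¬GProof Inv₁-resp (λ ι (g , nc) → Inv₁-step ι g (inj₁ nc)) Inv₁-S₁

  CutFreeC : Inst → Set
  CutFreeC ι = isC ι × notCut ι

  Γ₀ Γ₁ Γ₃ : List Fm
  Γ₀ = proj₁ S₁
  Γ₁ = box α (box α* yield) ∷ q ∷ box α* preserve ∷ []
  Γ₃ = yield ∷ box α (box α* yield) ∷ box α (box α* preserve) ∷ q ∷ []

  next-p : Fm
  next-p = box α (box α* p)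

  derivation₁ : Derivation CutFreeC (S₁ ≈S_) S₁
  derivation₁ =
    by (cs α p Γ₀ []) _
      ( by (starL α yield (q ∷ box α* preserve ∷ []) (p ∷ [])) _
          ( by (impL Γ₁ (p ∷ []) q p) _
              ( by (ax Γ₁ (p ∷ []) q) _ []
              ∷ by (ax Γ₁ [] p) _ []
              ∷ [])
          ∷ [])
      ∷ by (starL α preserve (q ∷ box α* yield ∷ []) (next-p ∷ [])) _
          ( by (starL α yield (preserve ∷ box α (box α* preserve) ∷ q ∷ []) (next-p ∷ [])) _
              ( by (impL Γ₃ (next-p ∷ []) q (box α q)) _
                  ( by (ax Γ₃ (next-p ∷ []) q) _ []
                  ∷ by (wk (map (box α) Γ₀) (next-p ∷ []) (box α q ∷ Γ₃) (next-p ∷ []) ⊆-byDecision ⊆-refl) _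
                      ( by (boxR α Γ₀ (box α* p) []) _ (bud ≈S-refl ∷ [])
                      ∷ [])
                  ∷ [])
              ∷ [])
          ∷ [])
      ∷ [])

  t₁ : PT
  t₁ = tree derivation₁

  data OnCycle₁ : Pos t₁ → Set where
    at-cs       : OnCycle₁ here
    at-preserve : OnCycle₁ (child (fsuc fzero) here)
    at-yield    : OnCycle₁ (child (fsuc fzero) (child fzero here))
    at-impL     : OnCycle₁ (child (fsuc fzero) (child fzero (child fzero here)))
    at-wk       : OnCycle₁ (child (fsuc fzero) (child fzero (child fzero (child (fsuc fzero) here))))
    at-boxR     : OnCycle₁ (child (fsuc fzero) (child fzero (child fzero (child (fsuc fzero) (child fzero here)))))

  open DerivationGraph t₁ toRoot

  classify₁ : ∀ pos → OnCycle₁ pos ⊎ NoBuds (sub t₁ pos) ⊎ IsBud (sub t₁ pos)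
  classify₁ here = inj₁ at-cs
  classify₁ (child fzero pos) = inj₂ (inj₁ (sub-noBuds _ pos))
  classify₁ (child (fsuc fzero) here) = inj₁ at-preserve
  classify₁ (child (fsuc fzero) (child fzero here)) = inj₁ at-yield
  classify₁ (child (fsuc fzero) (child fzero (child fzero here))) = inj₁ at-impL
  classify₁ (child (fsuc fzero) (child fzero (child fzero (child fzero pos)))) = inj₂ (inj₁ (sub-noBuds _ pos))
  classify₁ (child (fsuc fzero) (child fzero (child fzero (child (fsuc fzero) here)))) = inj₁ at-wk
  classify₁ (child (fsuc fzero) (child fzero (child fzero (child (fsuc fzero) (child fzero here))))) = inj₁ at-boxR
  classify₁ (child (fsuc fzero) (child fzero (child fzero (child (fsuc fzero) (child fzero (child fzero here)))))) =
    inj₂ (inj₂ (_ , refl))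

  trace₁ : ∀ {pos} → OnCycle₁ pos → Fm
  trace₁ at-cs = box α* p
  trace₁ _ = next-p

  rank₁ : ∀ {pos} → OnCycle₁ pos → ℕ
  rank₁ at-cs = 0
  rank₁ at-preserve = 5
  rank₁ at-yield = 4
  rank₁ at-impL = 3
  rank₁ at-wk = 2
  rank₁ at-boxR = 1

  step₁ : ∀ {pos j pos'} (c : OnCycle₁ pos) → Edge t₁ toRoot pos j pos' → (c' : OnCycle₁ pos') →
          (trace₁ c ∈ proj₂ (label (sub t₁ pos))) × TStepAt (sub t₁ pos) j (trace₁ c) (trace₁ c') ×
          (rank₁ c' < rank₁ c ⊎ ProgressAt (sub t₁ pos) j (trace₁ c) (trace₁ c'))
  step₁ at-cs (fzero , refl , inj₁ (_ , refl)) ()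
  step₁ at-cs (fsuc fzero , refl , inj₁ (_ , refl)) at-preserve = here refl , inj₂ (refl , refl) , inj₂ (refl , refl)
  step₁ at-preserve (fzero , refl , inj₁ (_ , refl)) at-yield = here refl , refl , inj₁ ≤-refl
  step₁ at-yield (fzero , refl , inj₁ (_ , refl)) at-impL = here refl , refl , inj₁ ≤-refl
  step₁ at-impL (fzero , refl , inj₁ (_ , refl)) ()
  step₁ at-impL (fsuc fzero , refl , inj₁ (_ , refl)) at-wk = here refl , refl , inj₁ ≤-refl
  step₁ at-wk (fzero , refl , inj₁ (_ , refl)) at-boxR = here refl , refl , inj₁ ≤-refl
  step₁ at-boxR (fzero , refl , inj₁ ((_ , _ , _ , ()) , _)) _
  step₁ at-boxR (fzero , refl , inj₂ (_ , refl)) at-cs = here refl , (refl , refl) , inj₁ ≤-refl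

  S₁-cutFreeC : CutFreeProvC S₁
  S₁-cutFreeC = cyclicDerivation⇒CProof derivation₁ (_ , _ , _ , refl) (cycleTrace⇒GlobalTrace record
    { OnCycle = OnCycle₁ ; classify = classify₁ ; trace = trace₁ ; rank = rank₁ ; step = step₁ })

module Part2 where

  r : Fm
  r = var 2

  Common : Inst → Set
  Common ι = isG ι × isC ι

  G₂ : Fm
  G₂ = box α (~ bbox α (~ r))

  S₂ : Seq
  S₂ = r ∷ [] , G₂ ∷ []

  derivation₂ : Derivation Common BudFree S₂
  derivation₂ =
    by (cut (r ∷ []) (G₂ ∷ []) (~ r)) _
      ( by (wk [] (G₂ ∷ ~ r ∷ []) (r ∷ []) (~ r ∷ G₂ ∷ []) (λ ()) ⊆-byDecision) _
          ( by (boxR α [] (~ bbox α (~ r)) (~ r ∷ [])) _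
              ( by (impR [] (bbox α (~ r) ∷ []) (bbox α (~ r)) ⊥') _
                  ( by (ax [] (⊥' ∷ []) (bbox α (~ r))) _ [] ∷ [])
              ∷ [])
          ∷ [])
      ∷ by (impL (r ∷ []) (G₂ ∷ []) r ⊥') _
          ( by (ax [] (G₂ ∷ []) r) _ []
          ∷ by (botL (r ∷ []) (G₂ ∷ [])) _ []
          ∷ [])
      ∷ [])

  Inside₂ : Seq → Set
  Inside₂ = Sides (_≡ r) (_≡ G₂)

  Outcome₂ : Seq → Set
  Outcome₂ s = Inside₂ s ⊎ Refutable s

  inside₂-step : ∀ ι → notCut ι → Inside₂ (concl ι) → Any Outcome₂ (prems ι)
  inside₂-step (ax Γ Δ φ) _ (refl ∷ _ , () ∷ _)
  inside₂-step (botL Γ Δ) _ (() ∷ _ , _)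
  inside₂-step (impL Γ Δ φ ψ) _ (() ∷ _ , _)
  inside₂-step (impR Γ Δ φ ψ) _ (_ , () ∷ _)
  inside₂-step (wk Γ Δ Γ' Δ' Γ⊆ Δ⊆) _ inside = here (inj₁ (Sides-⊇ˢ (Γ⊆ , Δ⊆) inside))
  inside₂-step (boxR π [] φ Δ) _ ([] , refl ∷ G₂s) =
    here (inj₂ (w₁ , [] , ~-false (bbox α (~ r)) ←~r-holds ∷ All.map⁺ (All.map (λ { refl → G₂-fails }) G₂s)))
    where
    ←~r-holds : ⟦ bbox α (~ r) ⟧ w₁ ≡ true
    ←~r-holds = □-intro λ { w₀ _ → refl ; w₁ _ → refl }

    G₂-fails : ⟦ bbox α G₂ ⟧ w₁ ≡ false
    G₂-fails = □-refute {v = w₁} refl (□-refute {v = w₁} refl (~-false (bbox α (~ r)) ←~r-holds))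
  inside₂-step (boxR π (_ ∷ _) φ Δ) _ (() ∷ _ , _)
  inside₂-step (bboxR π Γ φ Δ) _ (_ , () ∷ _)
  inside₂-step (seqL π₀ π₁ φ Γ Δ) _ (() ∷ _ , _)
  inside₂-step (seqR π₀ π₁ φ Γ Δ) _ (_ , () ∷ _)
  inside₂-step (cupL π₀ π₁ φ Γ Δ) _ (() ∷ _ , _)
  inside₂-step (cupR π₀ π₁ φ Γ Δ) _ (_ , () ∷ _)
  inside₂-step (starL π φ Γ Δ) _ (() ∷ _ , _)
  inside₂-step (testL φ ψ Γ Δ) _ (() ∷ _ , _)
  inside₂-step (testR φ ψ Γ Δ) _ (_ , () ∷ _)
  inside₂-step (starR π Γ φ) _ (_ , () ∷ _)
  inside₂-step (cs π φ Γ Δ) _ (_ , () ∷ _)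

  Inv₂ : Seq → Set
  Inv₂ s = Sides StarFree StarFree s × Outcome₂ s

  Inv₂-resp : Inv₂ Respects _≈S_
  Inv₂-resp s≈s' (starFree , inj₁ inside) = Sides-resp s≈s' starFree , inj₁ (Sides-resp s≈s' inside)
  Inv₂-resp s≈s' (starFree , inj₂ refutable) = Sides-resp s≈s' starFree , inj₂ (Refutable-⊇ˢ (≈S⇒⊇ˢ s≈s') refutable)

  Inv₂-step : ∀ ι → notCut ι → Inv₂ (concl ι) → Any Inv₂ (prems ι) × NoProgress ι
  Inv₂-step ι nc (starFree , outcome) =
    let starFrees , noProgress = starFree-step ι nc starFree
    in zip-All-Any starFrees (outcome-step outcome) , noProgress
    where
    outcome-step : Outcome₂ (concl ι) → Any Outcome₂ (prems ι)
    outcome-step (inj₁ inside) = inside₂-step ι nc inside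
    outcome-step (inj₂ refutable) = Any.map inj₂ (rule-sound ι refutable)

  Inv₂-S₂ : Inv₂ S₂
  Inv₂-S₂ = (_ ∷ [] , _ ∷ []) , inj₁ (refl ∷ [] , refl ∷ [])

  S₂-provableG : ProvG S₂
  S₂-provableG = derivation⇒GProof (Derivation-map proj₁ derivation₂)

  S₂-provableC : ProvC S₂
  S₂-provableC = derivation⇒CProof (Derivation-map proj₂ derivation₂)

  S₂-not-cutFreeG : ¬ CutFreeProvG S₂
  S₂-not-cutFreeG = Invariant.invariant⇒¬GProof Inv₂-resp (λ ι (_ , nc) → proj₁ ∘ Inv₂-step ι nc) Inv₂-S₂

  S₂-not-cutFreeC : ¬ CutFreeProvC S₂
  S₂-not-cutFreeC = Invariant.invariant⇒¬CProof Inv₂-resp (λ ι (_ , nc) → Inv₂-step ι nc) Inv₂-S₂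

mainTheorem13 : ((Σ Seq λ s → (¬ CutFreeProvG s) × CutFreeProvC s) × (Σ Seq λ s → (¬ FLCutProvG s) × CutFreeProvC s)) × (Σ Seq λ s → ProvG s × ProvC s × (¬ CutFreeProvG s) × (¬ CutFreeProvC s))
mainTheorem13 =
  ((S₁ , S₁-not-cutFreeG , S₁-cutFreeC) , (S₁ , S₁-not-FLCutG , S₁-cutFreeC)) ,
  (S₂ , S₂-provableG , S₂-provableC , S₂-not-cutFreeG , S₂-not-cutFreeC)
  where
  open Part1
  open Part2
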